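{- Let $\boldsymbol u\in\{0,1\}^\omega$. If $\varphi(\boldsymbol u)$ is faux-bonacci, then $\boldsymbol u$ is faux-bonacci.
   Context: $\varphi$ is the morphism $0\mapsto 01$, $1\mapsto 0$. For non-empty $X$, $X^-$ is $X$ with its last letter erased; a $4^-$-power is $XXXX^-$ with $X$ non-empty; a binary word is faux-bonacci if it has no factor $11$ and no factor that is a $4^-$-power. -}

module Defs where

open import Data.Bool using (Bool; true; false)
open import Data.Nat using (ℕ; zero; suc; _+_)
open import Data.List using (List; []; _∷_; _++_; length)
open import Data.Product using (∃; ∃-syntax; _×_)
open import Relation.Nullary using (¬_)
open import Relation.Binary.PropositionalEquality using (_≡_)

-- Letters: false = 0, true = 1.
-- Infinite binary words {0,1}^ω as functions ℕ → Bool.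
Word∞ : Set
Word∞ = ℕ → Bool

φ₁ : Bool → List Bool
φ₁ false = false ∷ true ∷ []
φ₁ true  = false ∷ []

φ : List Bool → List Bool
φ []       = []
φ (a ∷ w)  = φ₁ a ++ φ w

prefix : ℕ → Word∞ → List Bool
prefix zero    u = []
prefix (suc n) u = u zero ∷ prefix n (λ k → u (suc k))

-- n-th letter of a finite list (default false when out of range)
nth : ℕ → List Bool → Bool
nth n       []       = false
nth zero    (a ∷ w)  = a
nth (suc n) (a ∷ w)  = nth n w

-- φ applied to an infinite word: letter n of φ(u) is letter n of
-- φ(u₀ … uₙ), which has length ≥ n+1 since |φ(a)| ≥ 1 for each letter.
φ∞ : Word∞ → Word∞
φ∞ u n = nth n (φ (prefix (suc n) u))

factorAt : Word∞ → ℕ → ℕ → List Bool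
factorAt w i n = prefix n (λ k → w (i + k))

IsFactor : List Bool → Word∞ → Set
IsFactor X w = ∃[ i ] factorAt w i (length X) ≡ X

init : List Bool → List Bool
init []           = []
init (a ∷ [])     = []
init (a ∷ b ∷ w)  = a ∷ init (b ∷ w)

Is4⁻Power : List Bool → Set
Is4⁻Power Y = ∃[ a ] ∃[ X' ] (Y ≡ (a ∷ X') ++ (a ∷ X') ++ (a ∷ X') ++ init (a ∷ X'))

FauxBonacci : Word∞ → Set
FauxBonacci w = ¬ IsFactor (true ∷ true ∷ []) w
              × (∀ Y → IsFactor Y w → ¬ Is4⁻Power Y)

{-# OPTIONS --safe #-}
module Submission where

-- Every image φ₁ a begins with 0, so a factor Y of u yields the factor φ(Y)0 of φ(u).
-- Hence a factor 11 of u gives the 4⁻-power φ(11)0 = 000 in φ(u), and a factor XXXX⁻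
-- gives φ(XXXX⁻)0, which begins with the 4⁻-power φ(X)φ(X)φ(X)φ(X)⁻ because φ(X⁻)0
-- begins with φ(X)⁻.

open import Defs
open import Data.Bool using (Bool; true; false)
open import Data.Nat using (zero; suc; _+_; _≤_; _<_; z≤n; s≤s; z<s; s<s)
open import Data.Nat.Properties
  using (≤-total; ≤-trans; <-≤-trans; +-monoʳ-<; n<1+n; n≤1+n; m≤n⇒∃[o]m+o≡n)
open import Data.List using (List; []; _∷_; _++_; length)
open import Data.List.Properties using (++-assoc; ++-identityʳ; length-++; length-++-≤ˡ)
open import Data.Product using (∃-syntax; _,_)
open import Data.Sum using (inj₁; inj₂)
open import Relation.Nullary using (¬_)
open import Relation.Binary.PropositionalEquality
open ≡-Reasoning

infix 4 _⊑_

_⊑_ : List Bool → Word∞ → Set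
L ⊑ w = ∀ {m} → m < length L → nth m L ≡ w m

nth-++ˡ : ∀ A B {m} → m < length A → nth m (A ++ B) ≡ nth m A
nth-++ˡ (x ∷ A) B {zero}  _       = refl
nth-++ˡ (x ∷ A) B {suc m} (s<s p) = nth-++ˡ A B p

nth-++ʳ : ∀ A B k → nth (length A + k) (A ++ B) ≡ nth k B
nth-++ʳ []      B k = refl
nth-++ʳ (x ∷ A) B k = nth-++ʳ A B k

length-prefix : ∀ n (w : Word∞) → length (prefix n w) ≡ n
length-prefix zero    w = refl
length-prefix (suc n) w = cong suc (length-prefix n (λ k → w (suc k)))

nth-prefix : ∀ n (w : Word∞) {m} → m < n → nth m (prefix n w) ≡ w m
nth-prefix (suc n) w {zero}  _       = refl
nth-prefix (suc n) w {suc m} (s<s p) = nth-prefix n (λ k → w (suc k)) p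

prefix-+ : ∀ a b (w : Word∞) → prefix (a + b) w ≡ prefix a w ++ prefix b (λ k → w (a + k))
prefix-+ zero    b w = refl
prefix-+ (suc a) b w = cong (w zero ∷_) (prefix-+ a b (λ k → w (suc k)))

prefix-⊑ : ∀ n w → prefix n w ⊑ w
prefix-⊑ n w {m} p = nth-prefix n w (subst (m <_) (length-prefix n w) p)

⊑⇒prefix : ∀ L w → L ⊑ w → prefix (length L) w ≡ L
⊑⇒prefix []      w h = refl
⊑⇒prefix (x ∷ L) w h = cong₂ _∷_ (sym (h z<s)) (⊑⇒prefix L (λ k → w (suc k)) (λ p → h (s<s p)))

⊑-++ˡ : ∀ A B w → A ++ B ⊑ w → A ⊑ w
⊑-++ˡ A B w h p = trans (sym (nth-++ˡ A B p)) (h (<-≤-trans p (length-++-≤ˡ A)))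

⊑-++ʳ : ∀ A B w → A ++ B ⊑ w → B ⊑ (λ k → w (length A + k))
⊑-++ʳ A B w h {k} p =
  trans (sym (nth-++ʳ A B k)) (h (subst (length A + k <_) (sym (length-++ A)) (+-monoʳ-< (length A) p)))

⊑⇒IsFactor : ∀ A P B w → A ++ P ++ B ⊑ w → IsFactor P w
⊑⇒IsFactor A P B w h = length A , ⊑⇒prefix P _ (⊑-++ˡ P B _ (⊑-++ʳ A (P ++ B) w h))

IsFactor⇒⊑ : ∀ X w → IsFactor X w → ∃[ A ] ∃[ c ] A ++ X ++ c ∷ [] ⊑ w
IsFactor⇒⊑ X w (i , e) = prefix i w , _ , subst (_⊑ w) prefix≡ (prefix-⊑ (i + (length X + 1)) w)
  where
  prefix≡ : prefix (i + (length X + 1)) w ≡ prefix i w ++ X ++ w (i + (length X + 0)) ∷ []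
  prefix≡ = begin
    prefix (i + (length X + 1)) w
      ≡⟨ prefix-+ i (length X + 1) w ⟩
    prefix i w ++ prefix (length X + 1) (λ k → w (i + k))
      ≡⟨ cong (prefix i w ++_) (prefix-+ (length X) 1 (λ k → w (i + k))) ⟩
    prefix i w ++ factorAt w i (length X) ++ w (i + (length X + 0)) ∷ []
      ≡⟨ cong (λ Y → prefix i w ++ Y ++ w (i + (length X + 0)) ∷ []) e ⟩
    prefix i w ++ X ++ w (i + (length X + 0)) ∷ [] ∎

IsFactor-++ˡ : ∀ P Q w → IsFactor (P ++ Q) w → IsFactor P w
IsFactor-++ˡ P Q w (i , e) = i , ⊑⇒prefix P _ (⊑-++ˡ P Q _ (subst (_⊑ _) e (prefix-⊑ (length (P ++ Q)) (λ k → w (i + k)))))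

φ-++ : ∀ A B → φ (A ++ B) ≡ φ A ++ φ B
φ-++ []      B = refl
φ-++ (a ∷ A) B = trans (cong (φ₁ a ++_) (φ-++ A B)) (sym (++-assoc (φ₁ a) (φ A) (φ B)))

φ-[_] : ∀ a → φ (a ∷ []) ≡ φ₁ a
φ-[ a ] = ++-identityʳ (φ₁ a)

φ₁-head : ∀ a → ∃[ D ] φ₁ a ≡ false ∷ D
φ₁-head false = _ , refl
φ₁-head true  = _ , refl

length-φ : ∀ w → length w ≤ length (φ w)
length-φ []          = z≤n
length-φ (false ∷ w) = s≤s (≤-trans (length-φ w) (n≤1+n _))
length-φ (true ∷ w)  = s≤s (length-φ w)

φ-prefix-extends : ∀ u {N N'} → N ≤ N' → ∃[ B ] φ (prefix N' u) ≡ φ (prefix N u) ++ B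
φ-prefix-extends u {N} N≤N' with m≤n⇒∃[o]m+o≡n N≤N'
... | k , refl = _ , trans (cong φ (prefix-+ N k u)) (φ-++ (prefix N u) _)

nth-φ-prefix-stable : ∀ u {N N' m} → N ≤ N' → m < length (φ (prefix N u)) →
                      nth m (φ (prefix N' u)) ≡ nth m (φ (prefix N u))
nth-φ-prefix-stable u {N} N≤N' p with φ-prefix-extends u N≤N'
... | B , eq = trans (cong (nth _) eq) (nth-++ˡ (φ (prefix N u)) B p)

φ-prefix-⊑ : ∀ u N → φ (prefix N u) ⊑ φ∞ u
φ-prefix-⊑ u N {m} p with ≤-total N (suc m)
... | inj₁ N≤ = sym (nth-φ-prefix-stable u N≤ p)
... | inj₂ ≤N = nth-φ-prefix-stable u ≤N m<
  where
  m< : m < length (φ (prefix (suc m) u))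
  m< = <-≤-trans (subst (m <_) (sym (length-prefix (suc m) u)) (n<1+n m)) (length-φ (prefix (suc m) u))

φ-⊑ : ∀ L u → L ⊑ u → φ L ⊑ φ∞ u
φ-⊑ L u h = subst (λ L' → φ L' ⊑ φ∞ u) (⊑⇒prefix L u h) (φ-prefix-⊑ u (length L))

φ-IsFactor : ∀ Y u → IsFactor Y u → IsFactor (φ Y ++ false ∷ []) (φ∞ u)
φ-IsFactor Y u f with IsFactor⇒⊑ Y u f
... | A , c , h with φ₁-head c
...   | D , φc≡ = ⊑⇒IsFactor (φ A) _ D (φ∞ u) (subst (_⊑ φ∞ u) image≡ (φ-⊑ (A ++ Y ++ c ∷ []) u h))
  where
  image≡ : φ (A ++ Y ++ c ∷ []) ≡ φ A ++ (φ Y ++ false ∷ []) ++ D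
  image≡ = begin
    φ (A ++ Y ++ c ∷ [])            ≡⟨ φ-++ A _ ⟩
    φ A ++ φ (Y ++ c ∷ [])          ≡⟨ cong (φ A ++_) (φ-++ Y _) ⟩
    φ A ++ φ Y ++ φ (c ∷ [])        ≡⟨ cong (λ Z → φ A ++ φ Y ++ Z) (trans φ-[ c ] φc≡) ⟩
    φ A ++ φ Y ++ false ∷ D         ≡⟨ cong (φ A ++_) (sym (++-assoc (φ Y) _ D)) ⟩
    φ A ++ (φ Y ++ false ∷ []) ++ D ∎

init-++ : ∀ A b B → init (A ++ b ∷ B) ≡ A ++ init (b ∷ B)
init-++ []          b B = refl
init-++ (x ∷ [])    b B = refl
init-++ (x ∷ y ∷ A) b B = cong (x ∷_) (init-++ (y ∷ A) b B)

init-++-φ₁ : ∀ A b → init (A ++ φ₁ b) ≡ A ++ init (φ₁ b)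
init-++-φ₁ A false = init-++ A false _
init-++-φ₁ A true  = init-++ A false _

∷-init-last : ∀ a X → ∃[ b ] a ∷ X ≡ init (a ∷ X) ++ b ∷ []
∷-init-last a []      = a , refl
∷-init-last a (b ∷ X) with ∷-init-last b X
... | c , eq = c , cong (a ∷_) eq

φ₁-init : ∀ b → ∃[ R ] false ∷ [] ≡ init (φ₁ b) ++ R
φ₁-init false = [] , refl
φ₁-init true  = false ∷ [] , refl

φ-init : ∀ a X → ∃[ R ] φ (init (a ∷ X)) ++ false ∷ [] ≡ init (φ (a ∷ X)) ++ R
φ-init a X with ∷-init-last a X
... | b , split with φ₁-init b
...   | R , 0≡ = R , (begin
    φ X⁻ ++ false ∷ []          ≡⟨ cong (φ X⁻ ++_) 0≡ ⟩
    φ X⁻ ++ init (φ₁ b) ++ R    ≡⟨ sym (++-assoc (φ X⁻) _ R) ⟩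
    (φ X⁻ ++ init (φ₁ b)) ++ R  ≡⟨ cong (_++ R) (sym (init-++-φ₁ (φ X⁻) b)) ⟩
    init (φ X⁻ ++ φ₁ b) ++ R    ≡⟨ cong (λ Z → init Z ++ R) (sym φ-split) ⟩
    init (φ (a ∷ X)) ++ R       ∎)
  where
  X⁻ = init (a ∷ X)
  φ-split : φ (a ∷ X) ≡ φ X⁻ ++ φ₁ b
  φ-split = trans (cong φ split) (trans (φ-++ X⁻ _) (cong (φ X⁻ ++_) φ-[ b ]))

_⁴⁻ : List Bool → List Bool
W ⁴⁻ = W ++ W ++ W ++ init W

++-assoc⁴ : ∀ (A B C D S : List Bool) → (A ++ B ++ C ++ D) ++ S ≡ A ++ B ++ C ++ D ++ S
++-assoc⁴ A B C D S =
  trans (++-assoc A _ S) (cong (A ++_) (trans (++-assoc B _ S) (cong (B ++_) (++-assoc C D S))))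

φ-⁴⁻ : ∀ a X → ∃[ R ] φ ((a ∷ X) ⁴⁻) ++ false ∷ [] ≡ φ (a ∷ X) ⁴⁻ ++ R
φ-⁴⁻ a X with φ-init a X
... | R , φ-init≡ = R , (begin
    φ (Z ⁴⁻) ++ 0̂                              ≡⟨ cong (_++ 0̂) φ-cube ⟩
    (φ Z ++ φ Z ++ φ Z ++ φ (init Z)) ++ 0̂     ≡⟨ ++-assoc⁴ (φ Z) (φ Z) (φ Z) (φ (init Z)) 0̂ ⟩
    φ Z ++ φ Z ++ φ Z ++ φ (init Z) ++ 0̂       ≡⟨ cong (λ T → φ Z ++ φ Z ++ φ Z ++ T) φ-init≡ ⟩
    φ Z ++ φ Z ++ φ Z ++ init (φ Z) ++ R       ≡⟨ sym (++-assoc⁴ (φ Z) (φ Z) (φ Z) (init (φ Z)) R) ⟩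
    φ Z ⁴⁻ ++ R                                ∎)
  where
  Z  = a ∷ X
  0̂  = false ∷ []
  φ-cube : φ (Z ⁴⁻) ≡ φ Z ++ φ Z ++ φ Z ++ φ (init Z)
  φ-cube = trans (φ-++ Z _) (cong (φ Z ++_) (trans (φ-++ Z _) (cong (φ Z ++_) (φ-++ Z _))))

φ-∷ : ∀ a X → ∃[ W ] φ (a ∷ X) ≡ false ∷ W
φ-∷ a X with φ₁-head a
... | D , φa≡ = D ++ φ X , cong (_++ φ X) φa≡

φ-Is4⁻Power : ∀ a X → Is4⁻Power (φ (a ∷ X) ⁴⁻)
φ-Is4⁻Power a X with φ-∷ a X
... | W , φ≡ = false , W , cong _⁴⁻ φ≡

φ∞-IsFactor-⁴⁻ : ∀ a X u → IsFactor ((a ∷ X) ⁴⁻) u → IsFactor (φ (a ∷ X) ⁴⁻) (φ∞ u)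
φ∞-IsFactor-⁴⁻ a X u f with φ-⁴⁻ a X
... | R , eq = IsFactor-++ˡ _ R (φ∞ u) (subst (λ Y → IsFactor Y (φ∞ u)) eq (φ-IsFactor _ u f))

lemma1 : (u : Word∞) → FauxBonacci (φ∞ u) → FauxBonacci u
lemma1 u (_ , no4⁻) = no11 , no4⁻′
  where
  no11 : ¬ IsFactor (true ∷ true ∷ []) u
  no11 f = no4⁻ _ (φ-IsFactor _ u f) (false , [] , refl)

  no4⁻′ : ∀ Y → IsFactor Y u → ¬ Is4⁻Power Y
  no4⁻′ Y f (a , X , refl) = no4⁻ _ (φ∞-IsFactor-⁴⁻ a X u f) (φ-Is4⁻Power a X)
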